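{- For every integer $n\geqslant 2$ there exists a finite simple graph $G$ with $\mathrm{diam}(G)=2$ and $\mathrm{diam}(D_2(G))=n$.
   Context: All graphs are finite, simple and undirected. For a graph $G$, $\mathrm{d}(x,y)$ is the length of a shortest path between $x$ and $y$ in $G$, and $\mathrm{diam}(G)$ is the maximum distance between vertices of $G$. The $2$-distance graph $D_2(G)$ has vertex set $V(G)$, two vertices being adjacent if and only if their distance in $G$ is exactly $2$. -}

module Defs where

open import Data.Nat using (ℕ; zero; suc; _≤_; _<_)
open import Data.Fin using (Fin)
open import Data.Product using (Σ; _×_; ∃-syntax)
open import Relation.Nullary using (¬_)
open import Relation.Binary.PropositionalEquality using (_≡_)

Rel : ℕ → Set₁
Rel m = Fin m → Fin m → Set

IsSimple : ∀ {m} → Rel m → Set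
IsSimple {m} E = (∀ x → ¬ E x x) × (∀ x y → E x y → E y x)

data Walk {m} (E : Rel m) : ℕ → Fin m → Fin m → Set where
  here : ∀ {x} → Walk E zero x x
  step : ∀ {k x y z} → E x y → Walk E k y z → Walk E (suc k) x z

Dist : ∀ {m} → Rel m → Fin m → Fin m → ℕ → Set
Dist E x y k = Walk E k x y × (∀ j → j < k → ¬ Walk E j x y)

Diam : ∀ {m} → Rel m → ℕ → Set
Diam {m} E d =
  (∀ x y → ∃[ k ] (Dist E x y k × k ≤ d)) × (∃[ x ] ∃[ y ] Dist E x y d)

D₂ : ∀ {m} → Rel m → Rel m
D₂ E x y = Dist E x y 2

-- Take G to be the complement of the odd cycle C₂ₙ₊₁. Once the cycle has at least five
-- vertices, every cycle edge has a common non-neighbour, so two vertices are at distance 2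
-- in G exactly when they are adjacent in the cycle, and all other distinct pairs are
-- adjacent in G. Hence diam G = 2 and D₂(G) is C₂ₙ₊₁ itself, whose diameter is n; the lower
-- bound comes from the cycle distance to 0, which changes by at most one along an edge.
module Submission where

open import Defs
open import Data.Nat using (ℕ; zero; suc; _+_; _∸_; _⊓_; _≤_; _<_; z≤n; s≤s; _≟_; _≤?_)
open import Data.Nat.Induction using (<-rec)
open import Data.Nat.Properties
open import Data.Nat.Tactic.RingSolver using (solve-∀)
open import Data.Fin using (Fin; zero; toℕ; fromℕ; fromℕ<) renaming (_≟_ to _≟ᶠ_)
open import Data.Fin.Properties using (any?; toℕ-injective; toℕ<n; toℕ≤pred[n]; toℕ-fromℕ; toℕ-fromℕ<)
open import Data.Product using (Σ; _×_; _,_; proj₁; proj₂; ∃-syntax)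
open import Data.Sum using (_⊎_; inj₁; inj₂; [_,_])
open import Data.Empty using (⊥-elim)
open import Relation.Binary.Core using (_⇒_)
open import Relation.Binary.Definitions using (Decidable; Symmetric)
open import Relation.Binary.Construct.Closure.Symmetric using (SymClosure; fwd; bwd; symmetric)
open import Relation.Nullary using (¬_; Dec; yes; no)
open import Relation.Nullary.Decidable using (_×-dec_; _⊎-dec_; ¬?; map′; decidable-stable)
open import Relation.Binary.PropositionalEquality using (_≡_; _≢_; refl; sym; trans; cong; subst; module ≡-Reasoning)

module _ {m : ℕ} where

  mapWalk : {E F : Rel m} → E ⇒ F → ∀ {k x y} → Walk E k x y → Walk F k x y
  mapWalk f here       = here
  mapWalk f (step e w) = step (f e) (mapWalk f w)

  snocWalk : {E : Rel m} → ∀ {k x y z} → Walk E k x y → E y z → Walk E (suc k) x z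
  snocWalk here        e = step e here
  snocWalk (step e′ w) e = step e′ (snocWalk w e)

  reverseWalk : {E : Rel m} → Symmetric E → ∀ {k x y} → Walk E k x y → Walk E k y x
  reverseWalk E-sym here       = here
  reverseWalk E-sym (step e w) = snocWalk (reverseWalk E-sym w) (E-sym e)

  _++ʷ_ : {E : Rel m} → ∀ {j k x y z} → Walk E j x y → Walk E k y z → Walk E (j + k) x z
  here     ++ʷ w′ = w′
  step e w ++ʷ w′ = step e (w ++ʷ w′)

  walk? : {E : Rel m} → Decidable E → ∀ k → Decidable (Walk E k)
  walk? E? zero x y with x ≟ᶠ y
  ... | yes refl = yes here
  ... | no x≢y   = no λ { here → x≢y refl }
  walk? E? (suc k) x y =
    map′ (λ (_ , e , w) → step e w) (λ { (step e w) → _ , e , w })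
         (any? λ z → E? x z ×-dec walk? E? k z y)

  shortestWalk : {E : Rel m} → Decidable E → ∀ {x y} w → Walk E w x y →
                 ∃[ k ] (Dist E x y k × k ≤ w)
  shortestWalk {E} E? {x} {y} = <-rec _ λ w shorter W →
    case-shorter w W (anyUpTo? (λ j → walk? E? j x y) w) shorter
    where
    case-shorter : ∀ w → Walk E w x y → Dec (∃[ j ] (j < w × Walk E j x y)) →
                   (∀ {j} → j < w → Walk E j x y → ∃[ k ] (Dist E x y k × k ≤ j)) →
                   ∃[ k ] (Dist E x y k × k ≤ w)
    case-shorter w W (yes (j , j<w , V)) shorter =
      let k , d , k≤j = shorter j<w V in k , d , ≤-trans k≤j (<⇒≤ j<w)
    case-shorter w W (no none) _ = w , (W , λ j j<w V → none (j , j<w , V)) , ≤-refl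

  Diam-intro : {E : Rel m} → Decidable E → ∀ {d} →
               (∀ x y → ∃[ w ] (Walk E w x y × w ≤ d)) → (∃[ x ] ∃[ y ] Dist E x y d) →
               Diam E d
  Diam-intro E? walks far = bounded , far
    where
    bounded = λ x y → let w , W , w≤d = walks x y
                          k , dist , k≤w = shortestWalk E? w W
                      in k , dist , ≤-trans k≤w w≤d

  Dist-resp : {E F : Rel m} → E ⇒ F → F ⇒ E → ∀ {x y k} → Dist E x y k → Dist F x y k
  Dist-resp E⇒F F⇒E (W , minimal) = mapWalk E⇒F W , λ j j<k V → minimal j j<k (mapWalk F⇒E V)

  Diam-resp : {E F : Rel m} → E ⇒ F → F ⇒ E → ∀ {d} → Diam E d → Diam F d
  Diam-resp E⇒F F⇒E (bounded , x , y , dist) =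
    (λ x y → let k , d , k≤ = bounded x y in k , Dist-resp E⇒F F⇒E d , k≤) ,
    x , y , Dist-resp E⇒F F⇒E dist

  walk-potential : {E : Rel m} (f : Fin m → ℕ) → (∀ {x y} → E x y → f y ≤ suc (f x)) →
                   ∀ {j x y} → Walk E j x y → f y ≤ j + f x
  walk-potential f lip here = ≤-refl
  walk-potential f lip {suc j} {x} {y} (step e w) = begin
    f y             ≤⟨ walk-potential f lip w ⟩
    j + f _         ≤⟨ +-monoʳ-≤ j (lip e) ⟩
    j + suc (f x)   ≡⟨ +-suc j (f x) ⟩
    suc j + f x     ∎
    where open ≤-Reasoning

  Dist-from-potential : {E : Rel m} (f : Fin m → ℕ) → (∀ {x y} → E x y → f y ≤ suc (f x)) →
                        ∀ {k x y} → Walk E k x y → f y ≡ k + f x → Dist E x y k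
  Dist-from-potential f lip {k} {x} W fy≡k+fx = W , λ j j<k V →
    <⇒≱ j<k (+-cancelʳ-≤ (f x) k j (subst (_≤ j + f x) fy≡k+fx (walk-potential f lip V)))

  Dist2⇒nonadjacent : {E : Rel m} → ∀ {x y} → Dist E x y 2 → x ≢ y × ¬ E x y
  Dist2⇒nonadjacent (_ , minimal) =
    (λ { refl → minimal 0 (s≤s z≤n) here }) , (λ e → minimal 1 (s≤s (s≤s z≤n)) (step e here))

  Complement : Rel m → Rel m
  Complement H x y = x ≢ y × ¬ H x y

  Complement-sym : {H : Rel m} → Symmetric H → Symmetric (Complement H)
  Complement-sym H-sym (x≢y , ¬h) = (λ y≡x → x≢y (sym y≡x)) , (λ h → ¬h (H-sym h))

  Complement-isSimple : {H : Rel m} → Symmetric H → IsSimple (Complement H)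
  Complement-isSimple H-sym = (λ x (x≢x , _) → x≢x refl) , (λ x y → Complement-sym H-sym)

  Complement? : {H : Rel m} → Decidable H → Decidable (Complement H)
  Complement? H? x y = ¬? (x ≟ᶠ y) ×-dec ¬? (H? x y)

  CommonNeighbour : Rel m → Rel m
  CommonNeighbour E x y = ∃[ z ] (E x z × E z y)

  module SeparatedComplement {H : Rel m} (H? : Decidable H) (H-irrefl : ∀ {x} → ¬ H x x)
                             (separated : H ⇒ CommonNeighbour (Complement H)) where

    H⇒D₂-Complement : H ⇒ D₂ (Complement H)
    H⇒D₂-Complement {x} {y} h =
      let _ , c₁ , c₂ = separated h in step c₁ (step c₂ here) , noShorter
      where
      noShorter : ∀ j → j < 2 → ¬ Walk (Complement H) j x y
      noShorter 0 _ here                   = H-irrefl h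
      noShorter 1 _ (step (_ , ¬h) here)   = ¬h h
      noShorter (suc (suc _)) (s≤s (s≤s ()))

    D₂-Complement⇒H : D₂ (Complement H) ⇒ H
    D₂-Complement⇒H {x} {y} d =
      let x≢y , ¬c = Dist2⇒nonadjacent d in decidable-stable (H? x y) λ ¬h → ¬c (x≢y , ¬h)

    Complement-diam₂ : ∀ {x y} → H x y → Diam (Complement H) 2
    Complement-diam₂ h = Diam-intro (Complement? H?) within2 (_ , _ , H⇒D₂-Complement h)
      where
      within2 : ∀ x y → ∃[ w ] (Walk (Complement H) w x y × w ≤ 2)
      within2 x y with x ≟ᶠ y | H? x y
      ... | yes refl | _    = 0 , here , z≤n
      ... | no x≢y   | yes h = 2 , proj₁ (H⇒D₂-Complement h) , ≤-refl
      ... | no x≢y   | no ¬h = 1 , step (x≢y , ¬h) here , s≤s z≤n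

-- Cycle N is the cycle C_{N+1}; Next N a b says b ≡ a + 1 (mod N + 1).
Next : ℕ → ℕ → ℕ → Set
Next N a b = suc a ≡ b ⊎ (a ≡ N × b ≡ 0)

Cycle : ∀ N → Rel (suc N)
Cycle N x y = SymClosure (Next N) (toℕ x) (toℕ y)

module _ {N : ℕ} where

  Next? : ∀ a b → Dec (Next N a b)
  Next? a b = (suc a ≟ b) ⊎-dec ((a ≟ N) ×-dec (b ≟ 0))

  Cycle? : Decidable (Cycle N)
  Cycle? x y = map′ [ fwd , bwd ] (λ { (fwd n) → inj₁ n ; (bwd n) → inj₂ n })
                    (Next? (toℕ x) (toℕ y) ⊎-dec Next? (toℕ y) (toℕ x))

  Cycle-sym : Symmetric (Cycle N)
  Cycle-sym = symmetric (Next N)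

  Next-irrefl : 0 < N → ∀ {a} → ¬ Next N a a
  Next-irrefl _   (inj₁ 1+a≡a)       = 1+n≢n 1+a≡a
  Next-irrefl 0<N (inj₂ (refl , a≡0)) = <⇒≢ 0<N (sym a≡0)

  Cycle-irrefl : 0 < N → ∀ {x} → ¬ Cycle N x x
  Cycle-irrefl 0<N (fwd n) = Next-irrefl 0<N n
  Cycle-irrefl 0<N (bwd n) = Next-irrefl 0<N n

  Cycle-zero-fromℕ : Cycle N zero (fromℕ N)
  Cycle-zero-fromℕ = bwd (inj₂ (toℕ-fromℕ N , refl))

  Apart : ℕ → ℕ → Set
  Apart a b = a ≢ b × ¬ SymClosure (Next N) a b

  Apart-sym : ∀ {a b} → Apart a b → Apart b a
  Apart-sym (a≢b , ¬c) = (λ b≡a → a≢b (sym b≡a)) , (λ c → ¬c (symmetric (Next N) c))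

  gap⇒¬adjacent : ∀ {a b} → 2 + a ≤ b → (a ≡ 0 → b < N) → ¬ SymClosure (Next N) a b
  gap⇒¬adjacent a+2≤b _    (fwd (inj₁ refl))         = 1+n≰n a+2≤b
  gap⇒¬adjacent ()    _    (fwd (inj₂ (_ , refl)))
  gap⇒¬adjacent a+2≤b _    (bwd (inj₁ refl))         =
    1+n≰n (≤-trans (n≤1+n _) (≤-trans (n≤1+n _) a+2≤b))
  gap⇒¬adjacent _     wrap (bwd (inj₂ (refl , a≡0))) = n≮n N (wrap a≡0)

  gap⇒Apart : ∀ {a b} → 2 + a ≤ b → (a ≡ 0 → b < N) → Apart a b
  gap⇒Apart a+2≤b wrap =
    (λ { refl → 1+n≰n (≤-trans (n≤1+n _) a+2≤b) }) , gap⇒¬adjacent a+2≤b wrap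

  -- Every edge {a, a + 1} has a vertex at cycle distance at least 2 from both ends:
  -- a + 3 if it exists, otherwise a − 2; for the wrap-around edge {N, 0} take 2.
  Next-separated : 4 ≤ N → ∀ {a b} → b ≤ N → Next N a b →
                   ∃[ c ] (c ≤ N × Apart a c × Apart c b)
  Next-separated 4≤N _ (inj₂ (refl , refl)) =
    2 , 2≤N , Apart-sym (gap⇒Apart 4≤N λ ()) , Apart-sym (gap⇒Apart ≤-refl λ _ → <⇒≤ 4≤N)
    where 2≤N = ≤-trans (s≤s (s≤s z≤n)) 4≤N
  Next-separated 4≤N {a} a<N (inj₁ refl) with 3 + a ≤? N
  ... | yes a+3≤N =
    3 + a , a+3≤N , gap⇒Apart (n≤1+n _) (λ { refl → 4≤N }) , Apart-sym (gap⇒Apart ≤-refl λ ())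
  Next-separated 4≤N {suc (suc c)} a<N (inj₁ refl) | no _ =
    c , ≤-trans (n≤1+n _) (≤-trans (n≤1+n _) (<⇒≤ a<N)) ,
    Apart-sym (gap⇒Apart ≤-refl λ _ → a<N) , gap⇒Apart (n≤1+n _) (λ { refl → 4≤N })
  Next-separated 4≤N {0} a<N (inj₁ refl) | no a+3≰N = ⊥-elim (a+3≰N (<⇒≤ 4≤N))
  Next-separated 4≤N {1} a<N (inj₁ refl) | no a+3≰N = ⊥-elim (a+3≰N 4≤N)

  Apart⇒Complement : ∀ {x y} → Apart (toℕ x) (toℕ y) → Complement (Cycle N) x y
  Apart⇒Complement (a≢b , ¬c) = (λ x≡y → a≢b (cong toℕ x≡y)) , ¬c

  Cycle-separated : 4 ≤ N → Cycle N ⇒ CommonNeighbour (Complement (Cycle N))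
  Cycle-separated 4≤N {x} {y} (fwd n) = lift (Next-separated 4≤N (toℕ≤pred[n] y) n)
    where
    lift : ∃[ c ] (c ≤ N × Apart (toℕ x) c × Apart c (toℕ y)) →
           CommonNeighbour (Complement (Cycle N)) x y
    lift (c , c≤N , xc , cy) =
      fromℕ< (s≤s c≤N) ,
      Apart⇒Complement (subst (Apart (toℕ x)) (sym toℕz≡c) xc) ,
      Apart⇒Complement (subst (λ t → Apart t (toℕ y)) (sym toℕz≡c) cy)
      where toℕz≡c = toℕ-fromℕ< (s≤s c≤N)
  Cycle-separated 4≤N {x} {y} (bwd n) =
    let z , yz , zx = Cycle-separated 4≤N (fwd n)
    in z , Complement-sym {H = Cycle N} Cycle-sym zx , Complement-sym {H = Cycle N} Cycle-sym yz

  forwardWalk : ∀ d {x y : Fin (suc N)} → toℕ y ≡ d + toℕ x → Walk (Cycle N) d x y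
  forwardWalk zero {x} y≡x = subst (Walk (Cycle N) 0 x) (toℕ-injective (sym y≡x)) here
  forwardWalk (suc d) {x} {y} y≡d+1+x =
    step (fwd (inj₁ (sym (toℕ-fromℕ< x+1<N+1)))) (forwardWalk d y≡d+[x+1])
    where
    x+1<N+1 : suc (toℕ x) < suc N
    x+1<N+1 = ≤-trans (s≤s (s≤s (m≤n+m (toℕ x) d)))
                      (subst (λ t → suc t ≤ suc N) y≡d+1+x (toℕ<n y))
    y≡d+[x+1] : toℕ y ≡ d + toℕ (fromℕ< x+1<N+1)
    y≡d+[x+1] = begin
      toℕ y                    ≡⟨ y≡d+1+x ⟩
      suc d + toℕ x            ≡⟨ +-suc d (toℕ x) ⟨
      d + suc (toℕ x)          ≡⟨ cong (d +_) (toℕ-fromℕ< x+1<N+1) ⟨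
      d + toℕ (fromℕ< x+1<N+1) ∎
      where open ≡-Reasoning

  -- The two arcs between x ≤ y: forwards through x+1, …, y-1, and backwards through 0 and N.
  arcs : ∀ (x y : Fin (suc N)) → toℕ x ≤ toℕ y →
         ∃[ d ] ∃[ e ] (d + e ≡ suc N × Walk (Cycle N) d x y × Walk (Cycle N) e x y)
  arcs x y x≤y = d , toℕ x + suc e , arcLengths , forwardWalk d y≡d+x , backwards
    where
    d = proj₁ (m≤n⇒∃[o]m+o≡n x≤y)
    x+d≡y = proj₂ (m≤n⇒∃[o]m+o≡n x≤y)
    e = proj₁ (m≤n⇒∃[o]m+o≡n (toℕ≤pred[n] y))
    y+e≡N = proj₂ (m≤n⇒∃[o]m+o≡n (toℕ≤pred[n] y))

    y≡d+x : toℕ y ≡ d + toℕ x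
    y≡d+x = trans (sym x+d≡y) (+-comm (toℕ x) d)

    backwards : Walk (Cycle N) (toℕ x + suc e) x y
    backwards =
      reverseWalk Cycle-sym (forwardWalk (toℕ x) (sym (+-identityʳ (toℕ x)))) ++ʷ
      step Cycle-zero-fromℕ (reverseWalk Cycle-sym (forwardWalk e N≡e+y))
      where
      N≡e+y : toℕ (fromℕ N) ≡ e + toℕ y
      N≡e+y = trans (toℕ-fromℕ N) (trans (sym y+e≡N) (+-comm (toℕ y) e))

    arcLengths : d + (toℕ x + suc e) ≡ suc N
    arcLengths = begin
      d + (toℕ x + suc e)   ≡⟨ rearrange d (toℕ x) e ⟩
      suc (toℕ x + d + e)   ≡⟨ cong (λ t → suc (t + e)) x+d≡y ⟩
      suc (toℕ y + e)       ≡⟨ cong suc y+e≡N ⟩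
      suc N                 ∎
      where
      open ≡-Reasoning
      rearrange : ∀ d a e → d + (a + suc e) ≡ suc (a + d + e)
      rearrange = solve-∀

shorterArc : ∀ n {d e} → d + e ≡ suc (n + n) → d ≤ n ⊎ e ≤ n
shorterArc n {d} {e} d+e≡2n+1 with d ≤? n
... | yes d≤n = inj₁ d≤n
... | no d≰n  = inj₂ (+-cancelˡ-≤ d e n (subst (_≤ d + n) (sym d+e≡2n+1) (+-monoˡ-≤ n (≰⇒> d≰n))))

module _ (n : ℕ) where

  shortArc : ∀ (x y : Fin (suc (n + n))) → toℕ x ≤ toℕ y →
             ∃[ w ] (Walk (Cycle (n + n)) w x y × w ≤ n)
  shortArc x y x≤y with arcs x y x≤y
  ... | d , e , d+e≡2n+1 , D , E with shorterArc n d+e≡2n+1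
  ...   | inj₁ d≤n = d , D , d≤n
  ...   | inj₂ e≤n = e , E , e≤n

  oddCycle-walk : ∀ (x y : Fin (suc (n + n))) → ∃[ w ] (Walk (Cycle (n + n)) w x y × w ≤ n)
  oddCycle-walk x y with ≤-total (toℕ x) (toℕ y)
  ... | inj₁ x≤y = shortArc x y x≤y
  ... | inj₂ y≤x = let w , W , w≤n = shortArc y x y≤x in w , reverseWalk Cycle-sym W , w≤n

-- d₀ N a is the distance from 0 to a in the cycle on N + 1 vertices.
d₀ : ℕ → ℕ → ℕ
d₀ N a = a ⊓ (suc N ∸ a)

d₀-adjacent : ∀ {N a b} → a < suc N → SymClosure (Next N) a b → d₀ N b ≤ suc (d₀ N a)
d₀-adjacent {N} {a} _ (fwd (inj₁ refl)) =
  ⊓-mono-≤ ≤-refl (≤-trans (∸-monoʳ-≤ (suc N) (n≤1+n a)) (n≤1+n _))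
d₀-adjacent _ (fwd (inj₂ (refl , refl))) = z≤n
d₀-adjacent {N} {b = b} a<N+1 (bwd (inj₁ refl)) =
  subst (λ t → d₀ N b ≤ suc (suc b) ⊓ t) (+-∸-assoc 1 (<⇒≤ a<N+1))
        (⊓-mono-≤ (≤-trans (n≤1+n b) (n≤1+n _)) ≤-refl)
d₀-adjacent {N} _ (bwd (inj₂ (refl , refl))) = ≤-trans (m⊓n≤n N _) (≤-reflexive (m+n∸n≡m 1 N))

d₀-half : ∀ n → d₀ (n + n) n ≡ n
d₀-half n = trans (cong (n ⊓_) (m+n∸n≡m (suc n) n)) (m≤n⇒m⊓n≡m (n≤1+n n))

oddCycle-diam : ∀ n → Diam (Cycle (n + n)) n
oddCycle-diam n =
  Diam-intro Cycle? (oddCycle-walk n)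
    (zero , n̂ , Dist-from-potential height height-adjacent (forwardWalk n n̂≡n+0) height-n̂)
  where
  N = n + n
  n̂ : Fin (suc N)
  n̂ = fromℕ< (s≤s (m≤m+n n n))
  height : Fin (suc N) → ℕ
  height x = d₀ N (toℕ x)
  height-adjacent : ∀ {x y} → Cycle N x y → height y ≤ suc (height x)
  height-adjacent {x} = d₀-adjacent (toℕ<n x)
  n̂≡n+0 : toℕ n̂ ≡ n + 0
  n̂≡n+0 = trans (toℕ-fromℕ< _) (sym (+-identityʳ n))
  height-n̂ : height n̂ ≡ n + height zero
  height-n̂ = trans (cong (d₀ N) (toℕ-fromℕ< _)) (trans (d₀-half n) (sym (+-identityʳ n)))

mainTheorem1 : ∀ (n : ℕ) → 2 ≤ n →
    ∃[ m ] Σ (Rel m) (λ E → IsSimple E × Diam E 2 × Diam (D₂ E) n)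
mainTheorem1 n 2≤n =
  suc N , Complement (Cycle N) , Complement-isSimple Cycle-sym ,
  Complement-diam₂ Cycle-zero-fromℕ , Diam-resp H⇒D₂-Complement D₂-Complement⇒H (oddCycle-diam n)
  where
  N = n + n
  4≤N : 4 ≤ N
  4≤N = +-mono-≤ 2≤n 2≤n
  open SeparatedComplement (Cycle? {N}) (Cycle-irrefl (≤-trans (s≤s z≤n) 4≤N)) (Cycle-separated 4≤N)
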